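{- Let $d$ and $e$ be graphic elements of $\mathcal{P}_{s,n}$. If $d\succeq e$ and $e$ is canonically decomposable, then $d$ is canonically decomposable.
   Context: $\mathcal{P}_{s,n}$ is the set of nonincreasing lists of $n$ nonnegative integers with sum $s$, ordered by dominance: $a\succeq b$ if the sums agree and $\sum_{i=1}^j a_i\ge\sum_{i=1}^j b_i$ for all $j$. A list is graphic if it is the degree sequence of a finite simple graph. For a split graph $F$ with vertex partition into an independent set $A$ and a clique $B$, and a graph $H$, the composition $(F,A,B)\circ H$ is obtained from the disjoint union $F+H$ by adding all edges between $B$ and $V(H)$. A graph $G$ is canonically decomposable if $G=(F,A,B)\circ H$ for some nonempty induced subgraphs $F$ and $H$ and a partition $A,B$ of $V(F)$ into an independent set and a clique. A degree sequence is canonically decomposable if it has a canonically decomposable realization. -}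

module Defs where

open import Data.Nat using (ℕ; _≤_; _≥_)
open import Data.Bool using (Bool; true; false; if_then_else_)
open import Data.Fin using (Fin; _≤_)
open import Data.Vec using (Vec; lookup; toList)
open import Data.List using (List; allFin; map; take)
open import Data.Nat.ListAction using (sum)
open import Data.Sum using (_⊎_)
open import Data.Product using (_×_; Σ; ∃; ∃-syntax)
open import Relation.Binary.PropositionalEquality using (_≡_; _≢_)

record Graph (n : ℕ) : Set where
  field
    adj   : Fin n → Fin n → Bool
    sym   : ∀ u v → adj u v ≡ adj v u
    irref : ∀ v → adj v v ≡ false
open Graph public

deg : ∀ {n} → Graph n → Fin n → ℕ
deg G v = sum (map (λ u → if adj G v u then 1 else 0) (allFin _))

Nonincreasing : ∀ {n} → Vec ℕ n → Set
Nonincreasing {n} d = ∀ (i j : Fin n) → i Data.Fin.≤ j → lookup d j Data.Nat.≤ lookup d i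

InP : ℕ → (n : ℕ) → Vec ℕ n → Set
InP s n d = Nonincreasing d × sum (toList d) ≡ s

_⪰_ : ∀ {n} → Vec ℕ n → Vec ℕ n → Set
a ⪰ b = sum (toList a) ≡ sum (toList b)
      × (∀ (j : ℕ) → sum (take j (toList a)) Data.Nat.≥ sum (take j (toList b)))

-- G realizes d: vertex i of G has degree d_i
-- (every realization is isomorphic to one labelled this way)
Realizes : ∀ {n} → Graph n → Vec ℕ n → Set
Realizes {n} G d = ∀ (i : Fin n) → deg G i ≡ lookup d i

Graphic : ∀ {n} → Vec ℕ n → Set
Graphic {n} d = Σ (Graph n) λ G → Realizes G d

-- the three blocks of a canonical decomposition (F,A,B) ∘ H :
-- inA / inB are the vertices of F, inH the vertices of H
data Part : Set where
  inA inB inH : Part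

IsCanonicalDecomposition : ∀ {n} → Graph n → (Fin n → Part) → Set
IsCanonicalDecomposition {n} G p =
    (∃[ v ] (p v ≡ inA ⊎ p v ≡ inB))
  × (∃[ v ] p v ≡ inH)
  × (∀ u v → p u ≡ inA → p v ≡ inA → adj G u v ≡ false)
  × (∀ u v → p u ≡ inB → p v ≡ inB → u ≢ v → adj G u v ≡ true)
  × (∀ u v → p u ≡ inB → p v ≡ inH → adj G u v ≡ true)
  × (∀ u v → p u ≡ inA → p v ≡ inH → adj G u v ≡ false)

CanonicallyDecomposableGraph : ∀ {n} → Graph n → Set
CanonicallyDecomposableGraph {n} G = ∃[ p ] IsCanonicalDecomposition G p

CanonicallyDecomposable : ∀ {n} → Vec ℕ n → Set
CanonicallyDecomposable {n} d =
  Σ (Graph n) λ G → Realizes G d × CanonicallyDecomposableGraph G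

-- Label the vertices of a graph G by P : V → {A, B, H}; let β = |B| and
-- γ = |B ∪ H|.  Double counting the degrees gives, for every labelling,
--     β γ + Σ_v deg v  =  Σ_B deg + β + Σ_{B∪H} deg + defect,
-- where the defect counts the non-edges inside B × (B ∪ H) and the edges inside
-- A × (A ∪ H); it vanishes exactly when P is a canonical decomposition.  For a
-- decomposed realization of e, rearrangement bounds Σ_B e and Σ_{B∪H} e by
-- prefix sums of e, giving the inequality `Threshold b h e` with b = |B|,
-- h = |H|.  Prefix sums only grow under dominance, so `Threshold b h d` holds.
-- Finally, applying the identity to any realization of d labelled by its
-- first b, next h, remaining positions turns `Threshold b h d` into
-- defect ≤ 0, so that labelling is a canonical decomposition.

module Submission where

open import Defs renaming (sym to adj-sym)
open import Data.Nat.Base using (ℕ; zero; suc; _+_; _*_; _≤_; _<_; _<ᵇ_; z≤n; s≤s)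
open import Data.Nat.Properties
  using ( +-*-semiring; +-comm; +-assoc; +-identityʳ; *-comm; *-identityˡ; *-identityʳ
        ; *-zeroʳ; *-distribˡ-+; *-distribʳ-+; ≤-refl; ≤-reflexive; ≤-trans
        ; +-mono-≤; +-monoˡ-≤; +-monoʳ-≤; +-cancelˡ-≤; m≤m+n; m≤n+m; m≤n⇒m≤o+n
        ; m<m+n; n≤0⇒n≡0; m+n≡0⇒m≡0; m+n≡0⇒n≡0; module ≤-Reasoning )
open import Data.Nat.Tactic.RingSolver using (solve-∀)
open import Data.Nat.ListAction using (sum)
open import Data.Bool.Base using (Bool; true; false; not; if_then_else_)
open import Data.Fin.Base using (Fin; zero; suc; toℕ; fromℕ<)
open import Data.Fin.Properties using (_≟_; toℕ-fromℕ<)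
open import Data.Vec.Base using (Vec; []; _∷_; lookup; toList)
open import Data.List.Base using (take; tabulate)
open import Data.List.Properties using (map-tabulate)
open import Data.Product.Base using (_×_; _,_; proj₁; proj₂; ∃-syntax)
open import Data.Sum.Base using (_⊎_; inj₁; inj₂)
open import Function.Base using (_∘_)
open import Relation.Nullary using (does; yes; no; contradiction)
open import Relation.Binary.PropositionalEquality
open import Algebra.Properties.Semiring.Sum +-*-semiring
  using (sum-cong-≗; sum-replicate-zero; ∑-distrib-+; ∑-comm; *-distribˡ-sum)
  renaming (sum to ∑)

⟦_⟧ : Bool → ℕ
⟦ b ⟧ = if b then 1 else 0

-- Weighted sum Σᵢ Xᵢ wᵢ; for a 0/1-vector X it is the total of w over the set X.
infix 8 _·_
_·_ : ∀ {n} → (Fin n → ℕ) → (Fin n → ℕ) → ℕ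
X · w = ∑ (λ i → X i * w i)

∑-zero : ∀ {n} (f : Fin n → ℕ) → (∀ i → f i ≡ 0) → ∑ f ≡ 0
∑-zero {n} _ f≡0 = trans (sum-cong-≗ f≡0) (sum-replicate-zero n)

∑-zero⁻ : ∀ {n} (f : Fin n → ℕ) → ∑ f ≡ 0 → ∀ i → f i ≡ 0
∑-zero⁻ f ∑≡0 zero    = m+n≡0⇒m≡0 (f zero) ∑≡0
∑-zero⁻ f ∑≡0 (suc i) = ∑-zero⁻ (f ∘ suc) (m+n≡0⇒n≡0 (f zero) ∑≡0) i

term≤∑ : ∀ {n} (f : Fin n → ℕ) i → f i ≤ ∑ f
term≤∑ f zero    = m≤m+n (f zero) _
term≤∑ f (suc i) = m≤n⇒m≤o+n (f zero) (term≤∑ (f ∘ suc) i)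

sum-tabulate : ∀ {n} (f : Fin n → ℕ) → sum (tabulate f) ≡ ∑ f
sum-tabulate {zero}  f = refl
sum-tabulate {suc n} f = cong (f zero +_) (sum-tabulate (f ∘ suc))

∑-lookup : ∀ {n} (v : Vec ℕ n) → ∑ (lookup v) ≡ sum (toList v)
∑-lookup []      = refl
∑-lookup (x ∷ v) = cong (x +_) (∑-lookup v)

∑-ones : ∀ n → ∑ {n} (λ _ → 1) ≡ n
∑-ones zero    = refl
∑-ones (suc n) = cong suc (∑-ones n)

δ : ∀ {n} → Fin n → Fin n → ℕ
δ u v = ⟦ does (u ≟ v) ⟧

∑-δ : ∀ {n} (w : Fin n → ℕ) u → ∑ (λ v → w v * δ u v) ≡ w u
∑-δ w zero    = trans (cong₂ _+_ (*-identityʳ (w zero))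
                                 (∑-zero _ (λ v → *-zeroʳ (w (suc v)))))
                      (+-identityʳ (w zero))
∑-δ w (suc u) = trans (cong (_+ ∑ (λ v → w (suc v) * δ u v)) (*-zeroʳ (w zero)))
                      (∑-δ (w ∘ suc) u)

·-distrib-+ : ∀ {n} (X f g : Fin n → ℕ) → X · (λ i → f i + g i) ≡ X · f + X · g
·-distrib-+ X f g = trans (sum-cong-≗ (λ i → *-distribˡ-+ (X i) (f i) (g i)))
                          (∑-distrib-+ (λ i → X i * f i) (λ i → X i * g i))

·-distrib-+₃ : ∀ {n} (X f g h : Fin n → ℕ) →
               X · (λ i → f i + g i + h i) ≡ X · f + X · g + X · h
·-distrib-+₃ X f g h = trans (·-distrib-+ X (λ i → f i + g i) h)
                             (cong (_+ X · h) (·-distrib-+ X f g))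

·-const : ∀ {n} (X : Fin n → ℕ) c → X · (λ _ → c) ≡ c * ∑ X
·-const X c = trans (sum-cong-≗ (λ i → *-comm (X i) c)) (sym (*-distribˡ-sum c X))

·-ones : ∀ {n} (X : Fin n → ℕ) → X · (λ _ → 1) ≡ ∑ X
·-ones X = trans (·-const X 1) (*-identityˡ (∑ X))

·-zero : ∀ {n} {X w : Fin n → ℕ} → (∀ i → X i ≡ 0 ⊎ w i ≡ 0) → X · w ≡ 0
·-zero {X = X} {w} vanish = ∑-zero _ λ i → case i (vanish i)
  where
  case : ∀ i → X i ≡ 0 ⊎ w i ≡ 0 → X i * w i ≡ 0
  case i (inj₁ Xi≡0) = cong (_* w i) Xi≡0
  case i (inj₂ wi≡0) = trans (cong (X i *_) wi≡0) (*-zeroʳ (X i))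

·-zero⁻ : ∀ {n} (X w : Fin n → ℕ) → X · w ≡ 0 → ∀ i → X i ≡ 1 → w i ≡ 0
·-zero⁻ X w X·w≡0 i Xi≡1 =
  trans (sym (*-identityˡ (w i)))
        (trans (cong (_* w i) (sym Xi≡1)) (∑-zero⁻ (λ j → X j * w j) X·w≡0 i))

χA χB χH χBH χAH : Part → ℕ
χA inA = 1
χA _   = 0
χB inB = 1
χB _   = 0
χH inH = 1
χH _   = 0
χBH inA = 0
χBH _   = 1
χAH inB = 0
χAH _   = 1

χA+χBH : ∀ x → χA x + χBH x ≡ 1
χA+χBH inA = refl
χA+χBH inB = refl
χA+χBH inH = refl

χB+χAH : ∀ x → χB x + χAH x ≡ 1
χB+χAH inA = refl
χB+χAH inB = refl
χB+χAH inH = refl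

χBH≡χB+χH : ∀ x → χBH x ≡ χB x + χH x
χBH≡χB+χH inA = refl
χBH≡χB+χH inB = refl
χBH≡χB+χH inH = refl

size : ∀ {n} → (Part → ℕ) → (Fin n → Part) → ℕ
size χ P = ∑ (χ ∘ P)

·-split : ∀ {n} (χ χ' : Part → ℕ) → (∀ x → χ x + χ' x ≡ 1) →
          (P : Fin n → Part) (w : Fin n → ℕ) → ∑ w ≡ (χ ∘ P) · w + (χ' ∘ P) · w
·-split χ χ' cover P w = begin
  ∑ w                                       ≡⟨ sum-cong-≗ weight ⟩
  ∑ (λ i → χ (P i) * w i + χ' (P i) * w i)  ≡⟨ ∑-distrib-+ (λ i → χ (P i) * w i) _ ⟩
  (χ ∘ P) · w + (χ' ∘ P) · w                ∎
  where
  open ≡-Reasoning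
  weight : ∀ i → w i ≡ χ (P i) * w i + χ' (P i) * w i
  weight i = begin
    w i                              ≡⟨ *-identityˡ (w i) ⟨
    1 * w i                          ≡⟨ cong (_* w i) (cover (P i)) ⟨
    (χ (P i) + χ' (P i)) * w i       ≡⟨ *-distribʳ-+ (w i) (χ (P i)) (χ' (P i)) ⟩
    χ (P i) * w i + χ' (P i) * w i   ∎

χB≤1 : ∀ x → χB x ≤ 1
χB≤1 inA = z≤n
χB≤1 inB = ≤-refl
χB≤1 inH = z≤n

χBH≤1 : ∀ x → χBH x ≤ 1
χBH≤1 inA = z≤n
χBH≤1 inB = ≤-refl
χBH≤1 inH = ≤-refl

size-χBH : ∀ {n} (P : Fin n → Part) → size χBH P ≡ size χB P + size χH P
size-χBH P = trans (sum-cong-≗ (χBH≡χB+χH ∘ P)) (∑-distrib-+ (χB ∘ P) (χH ∘ P))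

size-cover : ∀ {n} (χ χ' : Part → ℕ) → (∀ x → χ x + χ' x ≡ 1) →
             (P : Fin n → Part) → size χ P + size χ' P ≡ n
size-cover {n} χ χ' cover P =
  trans (sym (∑-distrib-+ (χ ∘ P) (χ' ∘ P))) (trans (sum-cong-≗ (cover ∘ P)) (∑-ones n))

BlockConditions : ∀ {n} → Graph n → (Fin n → Part) → Set
BlockConditions G P =
    (∀ u v → P u ≡ inA → P v ≡ inA → adj G u v ≡ false)
  × (∀ u v → P u ≡ inB → P v ≡ inB → u ≢ v → adj G u v ≡ true)
  × (∀ u v → P u ≡ inB → P v ≡ inH → adj G u v ≡ true)
  × (∀ u v → P u ≡ inA → P v ≡ inH → adj G u v ≡ false)

module Counting {n} (G : Graph n) (P : Fin n → Part) where

  open ≡-Reasoning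

  edge : Fin n → Fin n → ℕ
  edge u v = ⟦ adj G u v ⟧

  nonEdge : Fin n → Fin n → ℕ
  nonEdge u v = if does (u ≟ v) then 0 else ⟦ not (adj G u v) ⟧

  pair-trichotomy : ∀ u v → edge u v + nonEdge u v + δ u v ≡ 1
  pair-trichotomy u v with u ≟ v
  ... | yes refl rewrite irref G u = refl
  ... | no _ with adj G u v
  ...   | true  = refl
  ...   | false = refl

  deg≡∑edge : ∀ u → deg G u ≡ ∑ (edge u)
  deg≡∑edge u = trans (cong sum (map-tabulate (λ v → v) (edge u))) (sum-tabulate (edge u))

  β γ : ℕ
  β = size χB P
  γ = size χBH P

  missing : Fin n → ℕ
  missing u = (χBH ∘ P) · nonEdge u

  nbrsA nbrsB nbrsAH : Fin n → ℕ
  nbrsA u  = (χA ∘ P) · edge u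
  nbrsB u  = (χB ∘ P) · edge u
  nbrsAH u = (χAH ∘ P) · edge u

  -- How far P is from a canonical decomposition: non-edges between B and
  -- B ∪ H, plus edges between A and A ∪ H.
  defect : ℕ
  defect = (χB ∘ P) · missing + (χA ∘ P) · nbrsAH

  -- A vertex of B is adjacent or non-adjacent to every other vertex of B ∪ H.
  B-degree : ∀ u → P u ≡ inB → deg G u + missing u + 1 ≡ γ + nbrsA u
  B-degree u Pu≡inB = begin
    deg G u + missing u + 1
      ≡⟨ cong (λ x → x + missing u + 1)
              (trans (deg≡∑edge u) (·-split χBH χA χBH+χA P (edge u))) ⟩
    BH·edge + nbrsA u + missing u + 1
      ≡⟨ cong (BH·edge + nbrsA u + missing u +_) diagonal ⟨
    BH·edge + nbrsA u + missing u + (χBH ∘ P) · δ u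
      ≡⟨ regroup BH·edge (nbrsA u) (missing u) ((χBH ∘ P) · δ u) ⟩
    BH·edge + missing u + (χBH ∘ P) · δ u + nbrsA u
      ≡⟨ cong (_+ nbrsA u) (·-distrib-+₃ (χBH ∘ P) (edge u) (nonEdge u) (δ u)) ⟨
    (χBH ∘ P) · (λ v → edge u v + nonEdge u v + δ u v) + nbrsA u
      ≡⟨ cong (_+ nbrsA u) (sum-cong-≗ (λ v → cong (χBH (P v) *_) (pair-trichotomy u v))) ⟩
    (χBH ∘ P) · (λ _ → 1) + nbrsA u
      ≡⟨ cong (_+ nbrsA u) (·-ones (χBH ∘ P)) ⟩
    γ + nbrsA u ∎
    where
    BH·edge : ℕ
    BH·edge = (χBH ∘ P) · edge u
    χBH+χA : ∀ x → χBH x + χA x ≡ 1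
    χBH+χA x = trans (+-comm (χBH x) (χA x)) (χA+χBH x)
    diagonal : (χBH ∘ P) · δ u ≡ 1
    diagonal = trans (∑-δ (χBH ∘ P) u) (cong χBH Pu≡inB)
    regroup : ∀ e a m d → e + a + m + d ≡ e + m + d + a
    regroup = solve-∀

  B-sum : (χB ∘ P) · deg G + (χB ∘ P) · missing + β ≡ γ * β + (χB ∘ P) · nbrsA
  B-sum = begin
    (χB ∘ P) · deg G + (χB ∘ P) · missing + β
      ≡⟨ cong ((χB ∘ P) · deg G + (χB ∘ P) · missing +_) (·-ones (χB ∘ P)) ⟨
    (χB ∘ P) · deg G + (χB ∘ P) · missing + (χB ∘ P) · (λ _ → 1)
      ≡⟨ ·-distrib-+₃ (χB ∘ P) (deg G) missing (λ _ → 1) ⟨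
    (χB ∘ P) · (λ u → deg G u + missing u + 1)
      ≡⟨ sum-cong-≗ pointwise ⟩
    (χB ∘ P) · (λ u → γ + nbrsA u)
      ≡⟨ ·-distrib-+ (χB ∘ P) (λ _ → γ) nbrsA ⟩
    (χB ∘ P) · (λ _ → γ) + (χB ∘ P) · nbrsA
      ≡⟨ cong (_+ (χB ∘ P) · nbrsA) (·-const (χB ∘ P) γ) ⟩
    γ * β + (χB ∘ P) · nbrsA ∎
    where
    pointwise : ∀ u → χB (P u) * (deg G u + missing u + 1) ≡ χB (P u) * (γ + nbrsA u)
    pointwise u with P u in Pu
    ... | inA = refl
    ... | inH = refl
    ... | inB = cong (1 *_) (B-degree u Pu)

  A-sum : (χA ∘ P) · deg G ≡ (χA ∘ P) · nbrsB + (χA ∘ P) · nbrsAH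
  A-sum = trans (sum-cong-≗ (λ u → cong (χA (P u) *_)
                   (trans (deg≡∑edge u) (·-split χB χAH χB+χAH P (edge u)))))
                (·-distrib-+ (χA ∘ P) nbrsB nbrsAH)

  handshake : ∀ (X Y : Fin n → ℕ) → X · (λ u → Y · edge u) ≡ Y · (λ u → X · edge u)
  handshake X Y = begin
    ∑ (λ u → X u * ∑ (λ v → Y v * edge u v))
      ≡⟨ sum-cong-≗ (λ u → *-distribˡ-sum (X u) (λ v → Y v * edge u v)) ⟩
    ∑ (λ u → ∑ (λ v → X u * (Y v * edge u v)))
      ≡⟨ ∑-comm (λ u v → X u * (Y v * edge u v)) ⟩
    ∑ (λ v → ∑ (λ u → X u * (Y v * edge u v)))
      ≡⟨ sum-cong-≗ (λ v → sum-cong-≗ (λ u → swap v u)) ⟩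
    ∑ (λ v → ∑ (λ u → Y v * (X u * edge v u)))
      ≡⟨ sum-cong-≗ (λ v → sym (*-distribˡ-sum (Y v) (λ u → X u * edge v u))) ⟩
    ∑ (λ v → Y v * ∑ (λ u → X u * edge v u)) ∎
    where
    swap : ∀ v u → X u * (Y v * edge u v) ≡ Y v * (X u * edge v u)
    swap v u rewrite adj-sym G u v = x*[y*z]≡y*[x*z] (X u) (Y v) (edge v u)
      where
      x*[y*z]≡y*[x*z] : ∀ x y z → x * (y * z) ≡ y * (x * z)
      x*[y*z]≡y*[x*z] = solve-∀

  degree-identity : β * γ + (χA ∘ P) · deg G ≡ (χB ∘ P) · deg G + β + defect
  degree-identity = begin
    β * γ + (χA ∘ P) · deg G
      ≡⟨ cong₂ _+_ (*-comm β γ) A-sum ⟩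
    γ * β + ((χA ∘ P) · nbrsB + (χA ∘ P) · nbrsAH)
      ≡⟨ cong (λ x → γ * β + (x + (χA ∘ P) · nbrsAH)) (handshake (χB ∘ P) (χA ∘ P)) ⟨
    γ * β + ((χB ∘ P) · nbrsA + (χA ∘ P) · nbrsAH)
      ≡⟨ +-assoc (γ * β) _ _ ⟨
    γ * β + (χB ∘ P) · nbrsA + (χA ∘ P) · nbrsAH
      ≡⟨ cong (_+ (χA ∘ P) · nbrsAH) B-sum ⟨
    (χB ∘ P) · deg G + (χB ∘ P) · missing + β + (χA ∘ P) · nbrsAH
      ≡⟨ regroup ((χB ∘ P) · deg G) ((χB ∘ P) · missing) β ((χA ∘ P) · nbrsAH) ⟩
    (χB ∘ P) · deg G + β + defect ∎
    where
    regroup : ∀ d m b z → d + m + b + z ≡ d + b + (m + z)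
    regroup = solve-∀

  nonEdge≡0⇒adjacent : ∀ u v → nonEdge u v ≡ 0 → u ≢ v → adj G u v ≡ true
  nonEdge≡0⇒adjacent u v nonEdge≡0 u≢v with u ≟ v
  nonEdge≡0⇒adjacent u v _  u≢v | yes u≡v = contradiction u≡v u≢v
  nonEdge≡0⇒adjacent u v _  _   | no _ with adj G u v
  nonEdge≡0⇒adjacent u v _  _   | no _ | true = refl
  nonEdge≡0⇒adjacent u v () _   | no _ | false

  adjacent⇒nonEdge≡0 : ∀ u v → (u ≢ v → adj G u v ≡ true) → nonEdge u v ≡ 0
  adjacent⇒nonEdge≡0 u v adjacent with u ≟ v
  ... | yes _   = refl
  ... | no u≢v rewrite adjacent u≢v = refl

  edge≡0⇒nonadjacent : ∀ u v → edge u v ≡ 0 → adj G u v ≡ false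
  edge≡0⇒nonadjacent u v edge≡0 with adj G u v
  edge≡0⇒nonadjacent u v () | true
  edge≡0⇒nonadjacent u v _  | false = refl

  defect≡0⇒conditions : defect ≡ 0 → BlockConditions G P
  defect≡0⇒conditions defect≡0 = AA , BB , BH , AH
    where
    missing≡0 : ∀ u → P u ≡ inB → missing u ≡ 0
    missing≡0 u Pu = ·-zero⁻ (χB ∘ P) missing (m+n≡0⇒m≡0 _ defect≡0) u (cong χB Pu)
    nbrsAH≡0 : ∀ u → P u ≡ inA → nbrsAH u ≡ 0
    nbrsAH≡0 u Pu = ·-zero⁻ (χA ∘ P) nbrsAH (m+n≡0⇒n≡0 _ defect≡0) u (cong χA Pu)
    BH-adjacent : ∀ u v → P u ≡ inB → χBH (P v) ≡ 1 → u ≢ v → adj G u v ≡ true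
    BH-adjacent u v Pu Pv =
      nonEdge≡0⇒adjacent u v (·-zero⁻ (χBH ∘ P) (nonEdge u) (missing≡0 u Pu) v Pv)
    AH-nonadjacent : ∀ u v → P u ≡ inA → χAH (P v) ≡ 1 → adj G u v ≡ false
    AH-nonadjacent u v Pu Pv =
      edge≡0⇒nonadjacent u v (·-zero⁻ (χAH ∘ P) (edge u) (nbrsAH≡0 u Pu) v Pv)
    AA : ∀ u v → P u ≡ inA → P v ≡ inA → adj G u v ≡ false
    AA u v Pu Pv = AH-nonadjacent u v Pu (cong χAH Pv)
    BB : ∀ u v → P u ≡ inB → P v ≡ inB → u ≢ v → adj G u v ≡ true
    BB u v Pu Pv = BH-adjacent u v Pu (cong χBH Pv)
    BH : ∀ u v → P u ≡ inB → P v ≡ inH → adj G u v ≡ true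
    BH u v Pu Pv = BH-adjacent u v Pu (cong χBH Pv) λ { refl → B≢H (trans (sym Pu) Pv) }
      where
      B≢H : inB ≢ inH
      B≢H ()
    AH : ∀ u v → P u ≡ inA → P v ≡ inH → adj G u v ≡ false
    AH u v Pu Pv = AH-nonadjacent u v Pu (cong χAH Pv)

  conditions⇒defect≡0 : BlockConditions G P → defect ≡ 0
  conditions⇒defect≡0 (AA , BB , BH , AH) = cong₂ _+_ (·-zero B-term) (·-zero A-term)
    where
    B-term : ∀ u → χB (P u) ≡ 0 ⊎ missing u ≡ 0
    B-term u with P u in Pu
    ... | inA = inj₁ refl
    ... | inH = inj₁ refl
    ... | inB = inj₂ (·-zero pair)
      where
      pair : ∀ v → χBH (P v) ≡ 0 ⊎ nonEdge u v ≡ 0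
      pair v with P v in Pv
      ... | inA = inj₁ refl
      ... | inB = inj₂ (adjacent⇒nonEdge≡0 u v (BB u v Pu Pv))
      ... | inH = inj₂ (adjacent⇒nonEdge≡0 u v (λ _ → BH u v Pu Pv))
    A-term : ∀ u → χA (P u) ≡ 0 ⊎ nbrsAH u ≡ 0
    A-term u with P u in Pu
    ... | inB = inj₁ refl
    ... | inH = inj₁ refl
    ... | inA = inj₂ (·-zero pair)
      where
      pair : ∀ v → χAH (P v) ≡ 0 ⊎ edge u v ≡ 0
      pair v with P v in Pv
      ... | inB = inj₁ refl
      ... | inA = inj₂ (cong ⟦_⟧ (AA u v Pu Pv))
      ... | inH = inj₂ (cong ⟦_⟧ (AH u v Pu Pv))

sequence-identity : ∀ {n} (G : Graph n) {v : Vec ℕ n} → Realizes G v → (P : Fin n → Part) →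
  let open Counting G P in
  β * γ + sum (toList v) ≡ (χB ∘ P) · lookup v + β + (χBH ∘ P) · lookup v + defect
sequence-identity G {v} G⊢v P = begin
  β * γ + sum (toList v)
    ≡⟨ cong (β * γ +_) (trans (sym (∑-lookup v)) (·-split χA χBH χA+χBH P (lookup v))) ⟩
  β * γ + ((χA ∘ P) · lookup v + BH)
    ≡⟨ +-assoc (β * γ) _ BH ⟨
  β * γ + (χA ∘ P) · lookup v + BH
    ≡⟨ cong (_+ BH) (trans (cong (β * γ +_) (sym (on-degrees χA))) degree-identity) ⟩
  (χB ∘ P) · deg G + β + defect + BH
    ≡⟨ cong (λ x → x + β + defect + BH) (on-degrees χB) ⟩
  (χB ∘ P) · lookup v + β + defect + BH
    ≡⟨ regroup ((χB ∘ P) · lookup v + β) defect BH ⟩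
  (χB ∘ P) · lookup v + β + BH + defect ∎
  where
  open ≡-Reasoning
  open Counting G P
  BH : ℕ
  BH = (χBH ∘ P) · lookup v
  on-degrees : ∀ χ → (χ ∘ P) · deg G ≡ (χ ∘ P) · lookup v
  on-degrees χ = sum-cong-≗ (λ i → cong (χ (P i) *_) (G⊢v i))
  regroup : ∀ x y z → x + y + z ≡ x + z + y
  regroup = solve-∀

prefixSum : ∀ {n} → ℕ → Vec ℕ n → ℕ
prefixSum k v = sum (take k (toList v))

below : ∀ {n} → ℕ → Fin n → ℕ
below k i = ⟦ toℕ i <ᵇ k ⟧

below·≡prefixSum : ∀ {n} k (v : Vec ℕ n) → below k · lookup v ≡ prefixSum k v
below·≡prefixSum zero    v       = ∑-zero (λ i → below 0 i * lookup v i) (λ _ → refl)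
below·≡prefixSum (suc k) []      = refl
below·≡prefixSum (suc k) (x ∷ v) = cong₂ _+_ (*-identityˡ x) (below·≡prefixSum k v)

∑-below : ∀ {n} k → k ≤ n → ∑ (below {n} k) ≡ k
∑-below {n} zero    _         = ∑-zero (below {n} 0) (λ _ → refl)
∑-below     (suc k) (s≤s k≤n) = cong suc (∑-below k k≤n)

prefixSum-step : ∀ {n} k y (v : Vec ℕ n) → (∀ i → lookup v i ≤ y) →
                 prefixSum (suc k) v ≤ y + prefixSum k v
prefixSum-step k       y []      _   = z≤n
prefixSum-step zero    y (x ∷ v) v≤y = +-monoˡ-≤ 0 (v≤y zero)
prefixSum-step (suc k) y (x ∷ v) v≤y = begin
  x + prefixSum (suc k) v    ≤⟨ +-monoʳ-≤ x (prefixSum-step k y v (v≤y ∘ suc)) ⟩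
  x + (y + prefixSum k v)    ≡⟨ +-comm x (y + prefixSum k v) ⟩
  y + prefixSum k v + x      ≡⟨ +-assoc y (prefixSum k v) x ⟩
  y + (prefixSum k v + x)    ≡⟨ cong (y +_) (+-comm (prefixSum k v) x) ⟩
  y + prefixSum (suc k) (x ∷ v) ∎
  where open ≤-Reasoning

prefixSum-push : ∀ {n} k y (v : Vec ℕ n) → (∀ i → lookup v i ≤ y) →
                 prefixSum k v ≤ prefixSum k (y ∷ v)
prefixSum-push zero    y v _   = z≤n
prefixSum-push (suc k) y v v≤y = prefixSum-step k y v v≤y

nonincreasing-tail : ∀ {n} {y} {v : Vec ℕ n} → Nonincreasing (y ∷ v) → Nonincreasing v
nonincreasing-tail y∷v↓ i j i≤j = y∷v↓ (suc i) (suc j) (s≤s i≤j)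

nonincreasing-head : ∀ {n} {y} {v : Vec ℕ n} → Nonincreasing (y ∷ v) → ∀ i → lookup v i ≤ y
nonincreasing-head y∷v↓ i = y∷v↓ zero (suc i) z≤n

rearrangement : ∀ {n} (v : Vec ℕ n) → Nonincreasing v →
                (x : Fin n → ℕ) → (∀ i → x i ≤ 1) →
                x · lookup v ≤ prefixSum (∑ x) v
rearrangement []      _  _ _   = z≤n
rearrangement (y ∷ v) y∷v↓ x x≤1 with x zero | x≤1 zero
... | 0 | _ =
  ≤-trans tail-bound (prefixSum-push (∑ (x ∘ suc)) y v (nonincreasing-head y∷v↓))
  where
  tail-bound : (x ∘ suc) · lookup v ≤ prefixSum (∑ (x ∘ suc)) v
  tail-bound = rearrangement v (nonincreasing-tail y∷v↓) (x ∘ suc) (x≤1 ∘ suc)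
... | 1 | _ = +-mono-≤ (≤-reflexive (*-identityˡ y))
                      (rearrangement v (nonincreasing-tail y∷v↓) (x ∘ suc) (x≤1 ∘ suc))
... | suc (suc _) | s≤s ()

-- The prefix labelling: positions 0 … b-1 form B, the next h positions form
-- H, and the remaining ones form A.
layer : ℕ → ℕ → ℕ → Part
layer (suc b) h       zero    = inB
layer (suc b) h       (suc m) = layer b h m
layer zero    (suc h) zero    = inH
layer zero    (suc h) (suc m) = layer zero h m
layer zero    zero    _       = inA

prefixLabel : ∀ {n} → ℕ → ℕ → Fin n → Part
prefixLabel b h i = layer b h (toℕ i)

χB-layer : ∀ b h m → χB (layer b h m) ≡ ⟦ m <ᵇ b ⟧
χB-layer (suc b) h       zero    = refl
χB-layer (suc b) h       (suc m) = χB-layer b h m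
χB-layer zero    (suc h) zero    = refl
χB-layer zero    (suc h) (suc m) = χB-layer zero h m
χB-layer zero    zero    _       = refl

χBH-layer : ∀ b h m → χBH (layer b h m) ≡ ⟦ m <ᵇ b + h ⟧
χBH-layer (suc b) h       zero    = refl
χBH-layer (suc b) h       (suc m) = χBH-layer b h m
χBH-layer zero    (suc h) zero    = refl
χBH-layer zero    (suc h) (suc m) = χBH-layer zero h m
χBH-layer zero    zero    _       = refl

layer-B : ∀ b h → 1 ≤ b → layer b h 0 ≡ inB
layer-B (suc b) h _ = refl

layer-H : ∀ h → 1 ≤ h → layer zero h 0 ≡ inH
layer-H (suc h) _ = refl

layer-skip : ∀ b h m → layer b h (b + m) ≡ layer zero h m
layer-skip zero    h m = refl
layer-skip (suc b) h m = layer-skip b h m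

layer-after-H : ∀ h → layer zero h h ≡ inA
layer-after-H zero    = refl
layer-after-H (suc h) = layer-after-H h

vertexAt : ∀ {n} m → m < n → ∃[ i ] toℕ i ≡ m
vertexAt m m<n = fromℕ< m<n , toℕ-fromℕ< m<n

DecompositionSizes : ℕ → ℕ → ℕ → Set
DecompositionSizes n b h = 1 ≤ h × b + h ≤ n × (1 ≤ b ⊎ b + h < n)

prefixLabel-nonempty : ∀ {n} b h → DecompositionSizes n b h →
    (∃[ v ] (prefixLabel b h v ≡ inA ⊎ prefixLabel b h v ≡ inB))
  × (∃[ v ] prefixLabel b h v ≡ inH)
prefixLabel-nonempty {n} b h (1≤h , b+h≤n , F-size) = F-vertex F-size , H-vertex 1≤h
  where
  F-vertex : 1 ≤ b ⊎ b + h < n → ∃[ v ] (prefixLabel b h v ≡ inA ⊎ prefixLabel b h v ≡ inB)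
  F-vertex (inj₁ 1≤b) with vertexAt 0 (≤-trans 1≤b (≤-trans (m≤m+n b h) b+h≤n))
  ... | v , v≡0 = v , inj₂ (trans (cong (layer b h) v≡0) (layer-B b h 1≤b))
  F-vertex (inj₂ b+h<n) with vertexAt (b + h) b+h<n
  ... | v , v≡b+h = v , inj₁ (trans (cong (layer b h) v≡b+h)
                                    (trans (layer-skip b h h) (layer-after-H h)))
  H-vertex : 1 ≤ h → ∃[ v ] prefixLabel b h v ≡ inH
  H-vertex 1≤h with vertexAt b (≤-trans (m<m+n b 1≤h) b+h≤n)
  ... | v , v≡b = v , trans (cong (layer b h) (trans v≡b (sym (+-identityʳ b))))
                            (trans (layer-skip b h 0) (layer-H h 1≤h))

decomposition-sizes : ∀ {n} {G : Graph n} {P : Fin n → Part} → IsCanonicalDecomposition G P →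
                      DecompositionSizes n (size χB P) (size χH P)
decomposition-sizes {n} {P = P} (F-vertex , (w , Pw≡inH) , _) =
  subst (λ x → χH x ≤ h) Pw≡inH (term≤∑ (χH ∘ P) w) , b+h≤n , F-size F-vertex
  where
  a b h : ℕ
  a = size χA P
  b = size χB P
  h = size χH P
  a+[b+h]≡n : a + (b + h) ≡ n
  a+[b+h]≡n = trans (cong (a +_) (sym (size-χBH P))) (size-cover χA χBH χA+χBH P)
  b+h≤n : b + h ≤ n
  b+h≤n = ≤-trans (m≤n+m (b + h) a) (≤-reflexive a+[b+h]≡n)
  F-size : ∃[ v ] (P v ≡ inA ⊎ P v ≡ inB) → 1 ≤ b ⊎ b + h < n
  F-size (v , inj₁ Pv≡inA) =
    inj₂ (≤-trans (+-monoˡ-≤ (b + h) 1≤a) (≤-reflexive a+[b+h]≡n))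
    where
    1≤a : 1 ≤ a
    1≤a = subst (λ x → χA x ≤ a) Pv≡inA (term≤∑ (χA ∘ P) v)
  F-size (v , inj₂ Pv≡inB) =
    inj₁ (subst (λ x → χB x ≤ b) Pv≡inB (term≤∑ (χB ∘ P) v))

Threshold : ∀ {n} → ℕ → ℕ → Vec ℕ n → Set
Threshold b h v = b * (b + h) + sum (toList v) ≤ prefixSum b v + b + prefixSum (b + h) v

decomposition⇒threshold : ∀ {n} (G : Graph n) {v : Vec ℕ n} (P : Fin n → Part) →
  Nonincreasing v → Realizes G v → BlockConditions G P → Threshold (size χB P) (size χH P) v
decomposition⇒threshold G {v} P v↓ G⊢v conditions = begin
  b * (b + h) + sum (toList v)
    ≡⟨ cong (λ g → b * g + sum (toList v)) (size-χBH P) ⟨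
  b * γ + sum (toList v)
    ≡⟨ sequence-identity G {v} G⊢v P ⟩
  B + b + BH + defect
    ≡⟨ trans (cong (B + b + BH +_) (conditions⇒defect≡0 conditions)) (+-identityʳ _) ⟩
  B + b + BH
    ≤⟨ +-mono-≤ (+-monoˡ-≤ b (rearrangement v v↓ (χB ∘ P) (χB≤1 ∘ P)))
                (rearrangement v v↓ (χBH ∘ P) (χBH≤1 ∘ P)) ⟩
  prefixSum b v + b + prefixSum γ v
    ≡⟨ cong (λ g → prefixSum b v + b + prefixSum g v) (size-χBH P) ⟩
  prefixSum b v + b + prefixSum (b + h) v ∎
  where
  open ≤-Reasoning
  open Counting G P using (γ; defect; conditions⇒defect≡0)
  b h B BH : ℕ
  b = size χB P
  h = size χH P
  B = (χB ∘ P) · lookup v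
  BH = (χBH ∘ P) · lookup v

-- Prefix sums grow under dominance, and the total is unchanged.
threshold-mono : ∀ {n} {b h} {d e : Vec ℕ n} → d ⪰ e → Threshold b h e → Threshold b h d
threshold-mono {b = b} {h} {d} {e} (Σd≡Σe , prefixes) e-bound = begin
  b * (b + h) + sum (toList d)             ≡⟨ cong (b * (b + h) +_) Σd≡Σe ⟩
  b * (b + h) + sum (toList e)             ≤⟨ e-bound ⟩
  prefixSum b e + b + prefixSum (b + h) e
    ≤⟨ +-mono-≤ (+-monoˡ-≤ b (prefixes b)) (prefixes (b + h)) ⟩
  prefixSum b d + b + prefixSum (b + h) d  ∎
  where open ≤-Reasoning

excess-zero : ∀ x y → x + y ≤ x → y ≡ 0
excess-zero x y x+y≤x =
  n≤0⇒n≡0 (+-cancelˡ-≤ x y 0 (≤-trans x+y≤x (≤-reflexive (sym (+-identityʳ x)))))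

-- Conversely, the inequality forces the prefix labelling of any realization
-- to be a canonical decomposition (no monotonicity of v is needed here).
threshold⇒decomposition : ∀ {n} (G : Graph n) {v : Vec ℕ n} b h → Realizes G v →
  DecompositionSizes n b h → Threshold b h v → IsCanonicalDecomposition G (prefixLabel b h)
threshold⇒decomposition {n} G {v} b h G⊢v sizes@(_ , b+h≤n , _) threshold =
  proj₁ nonempty , proj₂ nonempty , defect≡0⇒conditions defect≡0
  where
  P : Fin n → Part
  P = prefixLabel b h
  open Counting G P using (β; γ; defect; defect≡0⇒conditions)
  nonempty : (∃[ v ] (P v ≡ inA ⊎ P v ≡ inB)) × (∃[ v ] P v ≡ inH)
  nonempty = prefixLabel-nonempty b h sizes
  β≡b : β ≡ b
  β≡b = trans (sum-cong-≗ {y = below {n} b} (λ i → χB-layer b h (toℕ i)))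
              (∑-below {n} b (≤-trans (m≤m+n b h) b+h≤n))
  γ≡b+h : γ ≡ b + h
  γ≡b+h = trans (sum-cong-≗ {y = below {n} (b + h)} (λ i → χBH-layer b h (toℕ i)))
                (∑-below {n} (b + h) b+h≤n)
  B≡prefix : (χB ∘ P) · lookup v ≡ prefixSum b v
  B≡prefix = trans (sum-cong-≗ (λ i → cong (_* lookup v i) (χB-layer b h (toℕ i))))
                   (below·≡prefixSum b v)
  BH≡prefix : (χBH ∘ P) · lookup v ≡ prefixSum (b + h) v
  BH≡prefix = trans (sum-cong-≗ (λ i → cong (_* lookup v i) (χBH-layer b h (toℕ i))))
                    (below·≡prefixSum (b + h) v)
  defect≡0 : defect ≡ 0
  defect≡0 = excess-zero (prefixSum b v + b + prefixSum (b + h) v) defect (begin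
    prefixSum b v + b + prefixSum (b + h) v + defect
      ≡⟨ cong₂ (λ x y → x + y + defect) (cong₂ _+_ B≡prefix β≡b) BH≡prefix ⟨
    (χB ∘ P) · lookup v + β + (χBH ∘ P) · lookup v + defect
      ≡⟨ sequence-identity G {v} G⊢v P ⟨
    β * γ + sum (toList v)
      ≡⟨ cong₂ (λ x y → x * y + sum (toList v)) β≡b γ≡b+h ⟩
    b * (b + h) + sum (toList v)
      ≤⟨ threshold ⟩
    prefixSum b v + b + prefixSum (b + h) v ∎)
    where open ≤-Reasoning

-- Take the sizes b = |B|, h = |H| of a decomposition of a
-- realization of e; the inequality for (b, h) holds for e, hence for d ⪰ e,
-- and then the prefix labelling decomposes the given realization of d.
corollary4p4 : (s n : ℕ) (d e : Vec ℕ n) →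
    InP s n d → InP s n e → Graphic d → Graphic e →
    d ⪰ e → CanonicallyDecomposable e → CanonicallyDecomposable d
corollary4p4 s n d e _ (e↓ , _) (Gd , Gd⊢d) _ d⪰e (Ge , Ge⊢e , P , P-decomposes) =
  Gd , Gd⊢d , prefixLabel b h , threshold⇒decomposition Gd b h Gd⊢d sizes d-threshold
  where
  b h : ℕ
  b = size χB P
  h = size χH P
  sizes : DecompositionSizes n b h
  sizes = decomposition-sizes {G = Ge} P-decomposes
  e-threshold : Threshold b h e
  e-threshold = decomposition⇒threshold Ge P e↓ Ge⊢e (proj₂ (proj₂ P-decomposes))
  d-threshold : Threshold b h d
  d-threshold = threshold-mono {b = b} {h} d⪰e e-threshold
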